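{- Let $\mathbf{C}$ be a category with a stable system of monics $\mathcal{M}$ such that $\mathbf{C}$ has pushouts along $\mathcal{M}$-morphisms and $\mathcal{M}$-morphisms are stable under pushout. Then the source functor $S:\mathsf{PO}_v(\mathbf{C},\mathcal{M})\to\mathbf{C}|_{\mathcal{M}}$ is a Grothendieck opfibration, with the op-Cartesian liftings provided by pushouts.
   Context: A stable system of monics in $\mathbf{C}$ is a class $\mathcal{M}$ of monomorphisms containing all isomorphisms, closed under composition, and stable under pullback. $\mathbf{C}|_{\mathcal{M}}$ has the objects of $\mathbf{C}$ and the $\mathcal{M}$-morphisms as morphisms. $\mathbf{C}$ has pushouts along $\mathcal{M}$-morphisms if every span $A'\leftarrow A\to B$ with $A\to A'$ in $\mathcal{M}$ has a pushout; $\mathcal{M}$-morphisms are stable under pushout if in any pushout $A'\to B'\leftarrow B$ of such a span $A'\leftarrow A\to B$ with $A\to A'\in\mathcal{M}$, the morphism $B\to B'$ is in $\mathcal{M}$. $\mathsf{PO}_v(\mathbf{C},\mathcal{M})$ is the category whose objects are the morphisms of $\mathbf{C}$ and whose morphisms from $f:A\to B$ to $f':A'\to B'$ are pairs $(\alpha:A\to A',\beta:B\to B')$ with $\alpha,\beta\in\mathcal{M}$, $\beta\circ f=f'\circ\alpha$ and $(f',\beta)$ a pushout of the span $(\alpha,f)$; composition is vertical pasting. $S$ sends $f:A\to B$ to $A$ and $(\alpha,\beta)$ to $\alpha$. For a functor $G:\mathbf{E}\to\mathbf{B}$, a morphism $\varphi:e\to e'$ is op-Cartesian if for every $\psi:e\to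 e''$ and every $u:G(e')\to G(e'')$ with $u\circ G(\varphi)=G(\psi)$ there is a unique $\chi:e'\to e''$ with $G(\chi)=u$ and $\chi\circ\varphi=\psi$; $G$ is a Grothendieck opfibration if for every object $e$ and $f:G(e)\to b$ there is an op-Cartesian $\varphi$ with domain $e$ and $G(\varphi)=f$. -}

module Defs where

open import Level using (Level; _⊔_) renaming (suc to lsuc)
open import Relation.Binary using (IsEquivalence; Setoid)
open import Relation.Binary.PropositionalEquality using (_≡_; subst)
open import Data.Product using (Σ; Σ-syntax; _×_; _,_; proj₁; proj₂)
import Relation.Binary.Reasoning.Setoid as SetoidR

record Category (o h e : Level) : Set (lsuc (o ⊔ h ⊔ e)) where
  infix  4 _≈_
  infixr 9 _∘_
  field
    Obj       : Set o
    _⇒_       : Obj → Obj → Set h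
    _≈_       : ∀ {A B} → A ⇒ B → A ⇒ B → Set e
    id        : ∀ {A} → A ⇒ A
    _∘_       : ∀ {A B C} → B ⇒ C → A ⇒ B → A ⇒ C
    equiv     : ∀ {A B} → IsEquivalence (_≈_ {A} {B})
    ∘-resp-≈  : ∀ {A B C} {f g : B ⇒ C} {k l : A ⇒ B} → f ≈ g → k ≈ l → f ∘ k ≈ g ∘ l
    identityˡ : ∀ {A B} {f : A ⇒ B} → id ∘ f ≈ f
    identityʳ : ∀ {A B} {f : A ⇒ B} → f ∘ id ≈ f
    assoc     : ∀ {A B C D} {f : A ⇒ B} {g : B ⇒ C} {k : C ⇒ D} → (k ∘ g) ∘ f ≈ k ∘ (g ∘ f)

  hom-setoid : ∀ {A B} → Setoid h e
  hom-setoid {A} {B} = record { Carrier = A ⇒ B ; _≈_ = _≈_ ; isEquivalence = equiv }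

  module _ {A B : Obj} where
    open IsEquivalence (equiv {A} {B}) public
      renaming (refl to ≈-refl; sym to ≈-sym; trans to ≈-trans)

record Functor {o h e o′ h′ e′ : Level} (C : Category o h e) (D : Category o′ h′ e′)
       : Set (o ⊔ h ⊔ e ⊔ o′ ⊔ h′ ⊔ e′) where
  private
    module C = Category C
    module D = Category D
  field
    F₀           : C.Obj → D.Obj
    F₁           : ∀ {A B} → A C.⇒ B → F₀ A D.⇒ F₀ B
    identity     : ∀ {A} → F₁ (C.id {A}) D.≈ D.id
    homomorphism : ∀ {A B X} {f : A C.⇒ B} {g : B C.⇒ X} → F₁ (g C.∘ f) D.≈ F₁ g D.∘ F₁ f
    F-resp-≈     : ∀ {A B} {f g : A C.⇒ B} → f C.≈ g → F₁ f D.≈ F₁ g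

module _ {o h e : Level} (C : Category o h e) where
  open Category C

  Mono : ∀ {A B} → A ⇒ B → Set (o ⊔ h ⊔ e)
  Mono {A} f = ∀ {X} (g k : X ⇒ A) → f ∘ g ≈ f ∘ k → g ≈ k

  IsIso : ∀ {A B} → A ⇒ B → Set (h ⊔ e)
  IsIso {A} {B} f = Σ[ g ∈ B ⇒ A ] (g ∘ f ≈ id × f ∘ g ≈ id)

  record IsPushout {A B X P : Obj} (f : A ⇒ B) (g : A ⇒ X) (i₁ : B ⇒ P) (i₂ : X ⇒ P)
         : Set (o ⊔ h ⊔ e) where
    field
      commute   : i₁ ∘ f ≈ i₂ ∘ g
      universal : ∀ {Q} (h₁ : B ⇒ Q) (h₂ : X ⇒ Q) → h₁ ∘ f ≈ h₂ ∘ g →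
                  Σ[ u ∈ P ⇒ Q ] (u ∘ i₁ ≈ h₁ × u ∘ i₂ ≈ h₂)
      unique    : ∀ {Q} (u v : P ⇒ Q) → u ∘ i₁ ≈ v ∘ i₁ → u ∘ i₂ ≈ v ∘ i₂ → u ≈ v

  record IsPullback {A B X P : Obj} (f : B ⇒ X) (g : A ⇒ X) (p₁ : P ⇒ B) (p₂ : P ⇒ A)
         : Set (o ⊔ h ⊔ e) where
    field
      commute   : f ∘ p₁ ≈ g ∘ p₂
      universal : ∀ {Q} (h₁ : Q ⇒ B) (h₂ : Q ⇒ A) → f ∘ h₁ ≈ g ∘ h₂ →
                  Σ[ u ∈ Q ⇒ P ] (p₁ ∘ u ≈ h₁ × p₂ ∘ u ≈ h₂)
      unique    : ∀ {Q} (u v : Q ⇒ P) → p₁ ∘ u ≈ p₁ ∘ v → p₂ ∘ u ≈ p₂ ∘ v → u ≈ v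

  record StableSystem (ℓ : Level) : Set (o ⊔ h ⊔ e ⊔ lsuc ℓ) where
    field
      M         : ∀ {A B} → A ⇒ B → Set ℓ
      M-resp-≈  : ∀ {A B} {f g : A ⇒ B} → f ≈ g → M f → M g
      M-mono    : ∀ {A B} {f : A ⇒ B} → M f → Mono f
      M-iso     : ∀ {A B} {f : A ⇒ B} → IsIso f → M f
      M-∘       : ∀ {A B X} {f : A ⇒ B} {g : B ⇒ X} → M f → M g → M (g ∘ f)
      M-pullback : ∀ {A B X} (m : A ⇒ X) (f : B ⇒ X) → M m →
                   Σ[ P ∈ Obj ] Σ[ p₁ ∈ P ⇒ B ] Σ[ p₂ ∈ P ⇒ A ]
                     (IsPullback f m p₁ p₂ × M p₁)

  module _ {ℓ : Level} (SM : StableSystem ℓ) where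
    open StableSystem SM

    HasPushoutsAlongM : Set (o ⊔ h ⊔ e ⊔ ℓ)
    HasPushoutsAlongM = ∀ {A A′ B} (α : A ⇒ A′) (f : A ⇒ B) → M α →
      Σ[ B′ ∈ Obj ] Σ[ f′ ∈ A′ ⇒ B′ ] Σ[ β ∈ B ⇒ B′ ] IsPushout α f f′ β

    MStableUnderPushout : Set (o ⊔ h ⊔ e ⊔ ℓ)
    MStableUnderPushout = ∀ {A A′ B B′} (α : A ⇒ A′) (f : A ⇒ B) (f′ : A′ ⇒ B′) (β : B ⇒ B′) →
      M α → IsPushout α f f′ β → M β

module _ {o h e o′ h′ e′ : Level} {E : Category o h e} {B : Category o′ h′ e′}
         (G : Functor E B) where
  private
    module E = Category E
    module B = Category B
  open Functor G

  OpCartesian : ∀ {x y} → x E.⇒ y → Set (o ⊔ h ⊔ e ⊔ h′ ⊔ e′)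
  OpCartesian {x} {y} φ = ∀ {z} (ψ : x E.⇒ z) (u : F₀ y B.⇒ F₀ z) → u B.∘ F₁ φ B.≈ F₁ ψ →
    Σ[ χ ∈ y E.⇒ z ] ((F₁ χ B.≈ u × χ E.∘ φ E.≈ ψ) ×
      (∀ (χ′ : y E.⇒ z) → F₁ χ′ B.≈ u → χ′ E.∘ φ E.≈ ψ → χ′ E.≈ χ))

  IsOpfibration : Set (o ⊔ h ⊔ e ⊔ o′ ⊔ h′ ⊔ e′)
  IsOpfibration = ∀ (x : E.Obj) {b : B.Obj} (f : F₀ x B.⇒ b) →
    Σ[ y ∈ E.Obj ] Σ[ eq ∈ F₀ y ≡ b ] Σ[ φ ∈ x E.⇒ y ]
      (subst (F₀ x B.⇒_) eq (F₁ φ) B.≈ f × OpCartesian φ)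

module _ {o h e ℓ : Level} (C : Category o h e) (SM : StableSystem C ℓ) where
  open Category C
  open StableSystem SM

  private
    id-iso : ∀ {A} → IsIso C (id {A})
    id-iso = id , identityˡ , identityˡ

  C∣M : Category o (h ⊔ ℓ) e
  C∣M = record
    { Obj       = Obj
    ; _⇒_       = λ A B → Σ[ f ∈ A ⇒ B ] M f
    ; _≈_       = λ f g → proj₁ f ≈ proj₁ g
    ; id        = id , M-iso id-iso
    ; _∘_       = λ g f → (proj₁ g ∘ proj₁ f) , M-∘ (proj₂ f) (proj₂ g)
    ; equiv     = record { refl = ≈-refl ; sym = ≈-sym ; trans = ≈-trans }
    ; ∘-resp-≈  = ∘-resp-≈
    ; identityˡ = identityˡ
    ; identityʳ = identityʳ
    ; assoc     = assoc
    }

  record Arrow : Set (o ⊔ h) where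
    constructor arrow
    field
      {dom cod} : Obj
      arr       : dom ⇒ cod

  record POHom (F F′ : Arrow) : Set (o ⊔ h ⊔ e ⊔ ℓ) where
    private
      module F  = Arrow F
      module F′ = Arrow F′
    field
      α       : F.dom ⇒ F′.dom
      β       : F.cod ⇒ F′.cod
      α∈M     : M α
      β∈M     : M β
      pushout : IsPushout C α F.arr F′.arr β

  private
    idPO : ∀ {X} → POHom X X
    idPO {arrow f} = record
      { α = id ; β = id ; α∈M = M-iso id-iso ; β∈M = M-iso id-iso
      ; pushout = record
        { commute   = ≈-trans identityʳ (≈-sym identityˡ)
        ; universal = λ h₁ h₂ p → h₂ , ≈-sym (≈-trans (≈-sym identityʳ) p) , identityʳ
        ; unique    = λ u v _ q → ≈-trans (≈-sym identityʳ) (≈-trans q identityʳ)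
        }
      }

    compPO : ∀ {X Y Z} → POHom Y Z → POHom X Y → POHom X Z
    compPO {arrow f} {arrow f′} {arrow f″} G F = record
      { α = α′ ∘ α ; β = β′ ∘ β
      ; α∈M = M-∘ α∈M α′∈M ; β∈M = M-∘ β∈M β′∈M
      ; pushout = record
        { commute   = comm
        ; universal = univ
        ; unique    = uniq
        }
      }
      where
      open POHom F
      open POHom G renaming (α to α′; β to β′; α∈M to α′∈M; β∈M to β′∈M; pushout to pushout′)
      module P  = IsPushout pushout
      module P′ = IsPushout pushout′
      comm : f″ ∘ (α′ ∘ α) ≈ (β′ ∘ β) ∘ f
      comm = begin
        f″ ∘ (α′ ∘ α)   ≈⟨ ≈-sym assoc ⟩
        (f″ ∘ α′) ∘ α   ≈⟨ ∘-resp-≈ P′.commute ≈-refl ⟩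
        (β′ ∘ f′) ∘ α   ≈⟨ assoc ⟩
        β′ ∘ (f′ ∘ α)   ≈⟨ ∘-resp-≈ ≈-refl P.commute ⟩
        β′ ∘ (β ∘ f)    ≈⟨ ≈-sym assoc ⟩
        (β′ ∘ β) ∘ f    ∎
        where open SetoidR hom-setoid
      univ : ∀ {Q} (h₁ : _ ⇒ Q) (h₂ : _ ⇒ Q) → h₁ ∘ (α′ ∘ α) ≈ h₂ ∘ f →
             Σ[ u ∈ _ ⇒ Q ] (u ∘ f″ ≈ h₁ × u ∘ (β′ ∘ β) ≈ h₂)
      univ h₁ h₂ p with P.universal (h₁ ∘ α′) h₂ (≈-trans assoc p)
      ... | u , u₁ , u₂ with P′.universal h₁ u (≈-sym u₁)
      ... | v , v₁ , v₂ = v , v₁ , ≈-trans (≈-sym assoc) (≈-trans (∘-resp-≈ v₂ ≈-refl) u₂)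
      uniq : ∀ {Q} (u v : _ ⇒ Q) → u ∘ f″ ≈ v ∘ f″ → u ∘ (β′ ∘ β) ≈ v ∘ (β′ ∘ β) → u ≈ v
      uniq u v p q = P′.unique u v p (P.unique (u ∘ β′) (v ∘ β′) s t)
        where
        open SetoidR hom-setoid
        s : (u ∘ β′) ∘ f′ ≈ (v ∘ β′) ∘ f′
        s = begin
          (u ∘ β′) ∘ f′  ≈⟨ assoc ⟩
          u ∘ (β′ ∘ f′)  ≈⟨ ∘-resp-≈ ≈-refl (≈-sym P′.commute) ⟩
          u ∘ (f″ ∘ α′)  ≈⟨ ≈-sym assoc ⟩
          (u ∘ f″) ∘ α′  ≈⟨ ∘-resp-≈ p ≈-refl ⟩
          (v ∘ f″) ∘ α′  ≈⟨ assoc ⟩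
          v ∘ (f″ ∘ α′)  ≈⟨ ∘-resp-≈ ≈-refl P′.commute ⟩
          v ∘ (β′ ∘ f′)  ≈⟨ ≈-sym assoc ⟩
          (v ∘ β′) ∘ f′  ∎
        t : (u ∘ β′) ∘ β ≈ (v ∘ β′) ∘ β
        t = ≈-trans assoc (≈-trans q (≈-sym assoc))

  -- PO_v(C, M): objects are morphisms of C, morphisms are pushout squares
  -- with both vertical sides in M; composition is vertical pasting.
  PO-v : Category (o ⊔ h) (o ⊔ h ⊔ e ⊔ ℓ) e
  PO-v = record
    { Obj       = Arrow
    ; _⇒_       = POHom
    ; _≈_       = λ F G → (POHom.α F ≈ POHom.α G) × (POHom.β F ≈ POHom.β G)
    ; id        = idPO
    ; _∘_       = compPO
    ; equiv     = record
      { refl  = ≈-refl , ≈-refl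
      ; sym   = λ (p , q) → ≈-sym p , ≈-sym q
      ; trans = λ (p , q) (r , s) → ≈-trans p r , ≈-trans q s }
    ; ∘-resp-≈  = λ (p , q) (r , s) → ∘-resp-≈ p r , ∘-resp-≈ q s
    ; identityˡ = identityˡ , identityˡ
    ; identityʳ = identityʳ , identityʳ
    ; assoc     = assoc , assoc
    }

  S : Functor PO-v C∣M
  S = record
    { F₀           = Arrow.dom
    ; F₁           = λ F → POHom.α F , POHom.α∈M F
    ; identity     = ≈-refl
    ; homomorphism = ≈-refl
    ; F-resp-≈     = proj₁
    }

{-# OPTIONS --safe #-}
-- Every morphism (α , β) : f → f′ of PO_v is op-Cartesian over α. Given
-- (γ , δ) : f → f″ and u with u ∘ α = γ, the pushout property of (α , β)
-- gives the unique v with v ∘ f′ = f″ ∘ u and v ∘ β = δ; the square (u , v)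
-- is again a pushout because pushouts cancel under vertical pasting, and
-- v ∈ M since M is stable under pushout.
module Submission where

open import Defs
open import Level using (Level)
open import Data.Product using (Σ-syntax; _×_; _,_)
open import Relation.Binary.PropositionalEquality using (refl)
import Relation.Binary.Reasoning.Setoid as SetoidR

module PushoutPasting {o h e : Level} (C : Category o h e) where
  open Category C
  private
    open module HomReasoning {A B} = SetoidR (hom-setoid {A} {B})

  unglue-pushout : ∀ {A A′ A″ B B′ B″}
    {α : A ⇒ A′} {u : A′ ⇒ A″} {γ : A ⇒ A″} {f : A ⇒ B} {f′ : A′ ⇒ B′} {f″ : A″ ⇒ B″}
    {β : B ⇒ B′} {v : B′ ⇒ B″} {δ : B ⇒ B″} →
    IsPushout C α f f′ β → f″ ∘ u ≈ v ∘ f′ → u ∘ α ≈ γ → v ∘ β ≈ δ →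
    IsPushout C γ f f″ δ → IsPushout C u f′ f″ v
  unglue-pushout {A″ = A″} {B′ = B′} {B″} {α} {u} {γ} {f} {f′} {f″} {β} {v} {δ}
                 upper square uα≈γ vβ≈δ outer =
    record { commute = square ; universal = universal ; unique = unique }
    where
    module Upper = IsPushout upper
    module Outer = IsPushout outer

    universal : ∀ {Q} (h₁ : A″ ⇒ Q) (h₂ : B′ ⇒ Q) → h₁ ∘ u ≈ h₂ ∘ f′ →
                Σ[ w ∈ B″ ⇒ Q ] (w ∘ f″ ≈ h₁ × w ∘ v ≈ h₂)
    universal h₁ h₂ p with Outer.universal h₁ (h₂ ∘ β) outer-cocone
      where
      outer-cocone : h₁ ∘ γ ≈ (h₂ ∘ β) ∘ f
      outer-cocone = begin
        h₁ ∘ γ        ≈⟨ ∘-resp-≈ ≈-refl (≈-sym uα≈γ) ⟩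
        h₁ ∘ (u ∘ α)  ≈⟨ ≈-sym assoc ⟩
        (h₁ ∘ u) ∘ α  ≈⟨ ∘-resp-≈ p ≈-refl ⟩
        (h₂ ∘ f′) ∘ α ≈⟨ assoc ⟩
        h₂ ∘ (f′ ∘ α) ≈⟨ ∘-resp-≈ ≈-refl Upper.commute ⟩
        h₂ ∘ (β ∘ f)  ≈⟨ ≈-sym assoc ⟩
        (h₂ ∘ β) ∘ f  ∎
    ... | w , wf″≈h₁ , wδ≈h₂β = w , wf″≈h₁ , Upper.unique (w ∘ v) h₂ on-f′ on-β
      where
      on-f′ : (w ∘ v) ∘ f′ ≈ h₂ ∘ f′
      on-f′ = begin
        (w ∘ v) ∘ f′  ≈⟨ assoc ⟩
        w ∘ (v ∘ f′)  ≈⟨ ∘-resp-≈ ≈-refl (≈-sym square) ⟩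
        w ∘ (f″ ∘ u)  ≈⟨ ≈-sym assoc ⟩
        (w ∘ f″) ∘ u  ≈⟨ ∘-resp-≈ wf″≈h₁ ≈-refl ⟩
        h₁ ∘ u        ≈⟨ p ⟩
        h₂ ∘ f′       ∎
      on-β : (w ∘ v) ∘ β ≈ h₂ ∘ β
      on-β = begin
        (w ∘ v) ∘ β  ≈⟨ assoc ⟩
        w ∘ (v ∘ β)  ≈⟨ ∘-resp-≈ ≈-refl vβ≈δ ⟩
        w ∘ δ        ≈⟨ wδ≈h₂β ⟩
        h₂ ∘ β       ∎

    unique : ∀ {Q} (a b : B″ ⇒ Q) → a ∘ f″ ≈ b ∘ f″ → a ∘ v ≈ b ∘ v → a ≈ b
    unique a b on-f″ on-v = Outer.unique a b on-f″ (begin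
      a ∘ δ        ≈⟨ ∘-resp-≈ ≈-refl (≈-sym vβ≈δ) ⟩
      a ∘ (v ∘ β)  ≈⟨ ≈-sym assoc ⟩
      (a ∘ v) ∘ β  ≈⟨ ∘-resp-≈ on-v ≈-refl ⟩
      (b ∘ v) ∘ β  ≈⟨ assoc ⟩
      b ∘ (v ∘ β)  ≈⟨ ∘-resp-≈ ≈-refl vβ≈δ ⟩
      b ∘ δ        ∎)

module SourceOpfibration {o h e ℓ : Level} (C : Category o h e) (SM : StableSystem C ℓ)
       (pushouts : HasPushoutsAlongM C SM) (M-pushout : MStableUnderPushout C SM) where
  open Category C
  open StableSystem SM
  open PushoutPasting C
  open module HomReasoning {A B} = SetoidR (hom-setoid {A} {B})

  pushout⇒POHom : ∀ {A A′ B B′} {α : A ⇒ A′} {f : A ⇒ B} {f′ : A′ ⇒ B′} {β : B ⇒ B′} →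
                  M α → IsPushout C α f f′ β → POHom C SM (arrow f) (arrow f′)
  pushout⇒POHom {α = α} {f} {f′} {β} α∈M po = record
    { α = α ; β = β ; α∈M = α∈M ; β∈M = M-pushout α f f′ β α∈M po ; pushout = po }

  POHom-opCartesian : ∀ {X Y} (φ : Category._⇒_ (PO-v C SM) X Y) → OpCartesian (S C SM) φ
  POHom-opCartesian {arrow f} {arrow f′} φ {arrow f″} ψ (u , u∈M) uα≈γ with
    IsPushout.universal (POHom.pushout φ) (f″ ∘ u) (POHom.β ψ) cocone
    where
    open POHom φ using (α)
    open POHom ψ using () renaming (α to γ; β to δ; pushout to outer)
    cocone : (f″ ∘ u) ∘ α ≈ δ ∘ f
    cocone = begin
      (f″ ∘ u) ∘ α  ≈⟨ assoc ⟩
      f″ ∘ (u ∘ α)  ≈⟨ ∘-resp-≈ ≈-refl uα≈γ ⟩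
      f″ ∘ γ        ≈⟨ IsPushout.commute outer ⟩
      δ ∘ f         ∎
  ... | v , vf′≈f″u , vβ≈δ = χ , (≈-refl , uα≈γ , vβ≈δ) , unique
    where
    open POHom φ using (α; β) renaming (pushout to upper)
    open POHom ψ using () renaming (pushout to outer)

    χ : POHom C SM (arrow f′) (arrow f″)
    χ = pushout⇒POHom u∈M (unglue-pushout upper (≈-sym vf′≈f″u) uα≈γ vβ≈δ outer)

    unique : (χ′ : POHom C SM (arrow f′) (arrow f″)) → POHom.α χ′ ≈ u →
             (POHom.α χ′ ∘ α ≈ POHom.α ψ) × (POHom.β χ′ ∘ β ≈ POHom.β ψ) →
             (POHom.α χ′ ≈ u) × (POHom.β χ′ ≈ v)
    unique χ′ α′≈u (_ , β′β≈δ) =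
      α′≈u , IsPushout.unique upper β′ v on-f′ (≈-trans β′β≈δ (≈-sym vβ≈δ))
      where
      open POHom χ′ using () renaming (α to α′; β to β′)
      on-f′ : β′ ∘ f′ ≈ v ∘ f′
      on-f′ = begin
        β′ ∘ f′  ≈⟨ ≈-sym (IsPushout.commute (POHom.pushout χ′)) ⟩
        f″ ∘ α′  ≈⟨ ∘-resp-≈ ≈-refl α′≈u ⟩
        f″ ∘ u   ≈⟨ vf′≈f″u ⟨
        v ∘ f′   ∎

  S-isOpfibration : IsOpfibration (S C SM)
  S-isOpfibration (arrow f) (u , u∈M) with pushouts u f u∈M
  ... | _ , f′ , _ , po = arrow f′ , refl , φ , ≈-refl , POHom-opCartesian φ
    where
    φ : POHom C SM (arrow f) (arrow f′)
    φ = pushout⇒POHom u∈M po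

theorem5 : ∀ {o h e ℓ : Level} (C : Category o h e) (SM : StableSystem C ℓ) →
    HasPushoutsAlongM C SM → MStableUnderPushout C SM →
    IsOpfibration (S C SM) ×
    (∀ {X Y} (φ : Category._⇒_ (PO-v C SM) X Y) → OpCartesian (S C SM) φ)
theorem5 C SM pushouts M-pushout = S-isOpfibration , POHom-opCartesian
  where open SourceOpfibration C SM pushouts M-pushout
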